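{- Let $n\ge 1$ and let $\sigma$ be an edge 2-coloring of the complete graph $K_n$. Let $c$ be a color used by $\sigma$ such that $V(K_n^c)\subsetneq V(K_n)$. Then there are at most two colors $c'\ne c$ used by $\sigma$ such that $V(K_n^{c})\cap V(K_n^{c'})\neq\emptyset$.
   Context: An edge 2-coloring of a graph is an assignment of colors to its edges such that each vertex is incident to edges of at most 2 distinct colors. For a color $c$, the color subgraph $K_n^c$ is the subgraph of $K_n$ induced by the edges of color $c$; its vertex set $V(K_n^c)$ consists of the vertices incident to at least one edge of color $c$. Two color subgraphs "share vertices" if their vertex sets intersect. -}

module Defs where

open import Data.Nat using (ℕ)
open import Data.Fin using (Fin)
open import Data.Product using (Σ; ∃; _×_; _,_)
open import Relation.Binary.PropositionalEquality using (_≡_; _≢_)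
open import Relation.Nullary using (¬_)
open import Data.Empty using (⊥)

-- An edge colouring of K_n with colours from C: a colour for each ordered pair
-- of distinct vertices, required to be symmetric (so it colours unordered edges).
record EdgeColouring (n : ℕ) (C : Set) : Set where
  field
    col  : (u v : Fin n) → u ≢ v → C
    symm : (u v : Fin n) (p : u ≢ v) (q : v ≢ u) → col u v p ≡ col v u q
open EdgeColouring public

Incident : ∀ {n C} → EdgeColouring n C → C → Fin n → Set
Incident σ c v = ∃ λ w → Σ (v ≢ w) λ p → col σ v w p ≡ c

InV : ∀ {n C} → EdgeColouring n C → C → Fin n → Set
InV = Incident

Used : ∀ {n C} → EdgeColouring n C → C → Set
Used σ c = ∃ λ v → InV σ c v

-- edge 2-colouring: every vertex is incident to edges of at most 2 distinct colours
-- (no vertex sees three pairwise distinct colours)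
Is2Colouring : ∀ {n C} → EdgeColouring n C → Set
Is2Colouring {n} {C} σ = (v : Fin n) (a b d : C) →
  Incident σ a v → Incident σ b v → Incident σ d v →
  a ≢ b → a ≢ d → b ≢ d → ⊥

ProperVertexSet : ∀ {n C} → EdgeColouring n C → C → Set
ProperVertexSet {n} σ c = ∃ λ (v : Fin n) → ¬ InV σ c v

ShareVertex : ∀ {n C} → EdgeColouring n C → C → C → Set
ShareVertex {n} σ c c' = ∃ λ (v : Fin n) → InV σ c v × InV σ c' v

-- A vertex z missing colour c is joined to every vertex x of V(K_n^c). The edge
-- xz is not coloured c, so if x also sees a colour c' ≠ c then, x seeing at most
-- two colours, xz must be coloured c'. Hence z sees every colour c' ≠ c that meets
-- V(K_n^c), and there can be at most two of them. Colour equality is not assumed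
-- decidable, so "xz is coloured c'" is only obtained up to double negation, which
-- suffices since the conclusion is ⊥.
module Submission where

open import Defs
open import Data.Nat using (ℕ; _≥_)
open import Data.Fin using (Fin)
open import Data.Empty using (⊥)
open import Data.Product using (_,_)
open import Relation.Nullary using (¬_)
open import Relation.Binary.PropositionalEquality using (_≢_; _≡_; refl; sym; trans)

module _ {n : ℕ} {C : Set} (σ : EdgeColouring n C) where

  incident-reverse : ∀ {c u v} (p : u ≢ v) → col σ u v p ≡ c → Incident σ c v
  incident-reverse {u = u} {v} p e = u , q , trans (symm σ v u q p) e
    where
    q : v ≢ u
    q e = p (sym e)

  incident-≢-nonincident : ∀ {c x z} → Incident σ c x → ¬ Incident σ c z → x ≢ z
  incident-≢-nonincident ix ¬iz refl = ¬iz ix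

  module _ (two : Is2Colouring σ) {c : C} {z : Fin n} (¬iz : ¬ InV σ c z) where

    edge-to-missing-vertex-has-shared-colour :
      ∀ {c' x} (ix : InV σ c x) → InV σ c' x → c' ≢ c →
      ¬ ¬ (col σ x z (incident-≢-nonincident ix ¬iz) ≡ c')
    edge-to-missing-vertex-has-shared-colour {c'} {x} ix ix' c'≢c ≢c' =
      two x c c' (col σ x z x≢z) ix ix' (z , x≢z , refl)
        (λ e → c'≢c (sym e))
        (λ e → ¬iz (incident-reverse x≢z (sym e)))
        (λ e → ≢c' (sym e))
      where
      x≢z : x ≢ z
      x≢z = incident-≢-nonincident ix ¬iz

    missing-vertex-sees-shared-colour :
      ∀ {c'} → ShareVertex σ c c' → c' ≢ c → ¬ ¬ InV σ c' z
    missing-vertex-sees-shared-colour (x , ix , ix') c'≢c ¬iz' =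
      edge-to-missing-vertex-has-shared-colour ix ix' c'≢c λ e →
        ¬iz' (incident-reverse (incident-≢-nonincident ix ¬iz) e)

lemma2 : (n : ℕ) → n ≥ 1 → (C : Set) → (σ : EdgeColouring n C) → Is2Colouring σ →
    (c : C) → Used σ c → ProperVertexSet σ c →
    (c₁ c₂ c₃ : C) →
    Used σ c₁ → Used σ c₂ → Used σ c₃ →
    c₁ ≢ c → c₂ ≢ c → c₃ ≢ c →
    c₁ ≢ c₂ → c₁ ≢ c₃ → c₂ ≢ c₃ →
    ShareVertex σ c c₁ → ShareVertex σ c c₂ → ShareVertex σ c c₃ → ⊥
lemma2 _ _ _ σ two c _ (z , ¬iz) c₁ c₂ c₃ _ _ _ c₁≢c c₂≢c c₃≢c c₁≢c₂ c₁≢c₃ c₂≢c₃ sh₁ sh₂ sh₃ =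
  sees sh₁ c₁≢c λ i₁ →
  sees sh₂ c₂≢c λ i₂ →
  sees sh₃ c₃≢c λ i₃ →
  two z c₁ c₂ c₃ i₁ i₂ i₃ c₁≢c₂ c₁≢c₃ c₂≢c₃
  where
  sees : ∀ {c'} → ShareVertex σ c c' → c' ≢ c → ¬ ¬ InV σ c' z
  sees = missing-vertex-sees-shared-colour σ two ¬iz
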